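{- Let $G=(V,E)$ be a graph, $S'\subseteq V$, and $v\in S'$ with $|N(v)\setminus S'|=1$; let $x$ be the unique vertex of $N(v)\setminus S'$. Then no inclusion-minimal 2-club vertex deletion set $S$ of $G$ satisfies $S'\cup\{x\}\subseteq S$. Consequently, $x$ may be marked permanent when searching for inclusion-minimal 2-club vertex deletion sets containing $S'$.
   Context: All graphs are finite, simple and undirected. A 2-club is a graph of diameter at most two; a 2-club cluster graph is a graph each of whose connected components is a 2-club. A 2-club vertex deletion set of $G$ is a set $S\subseteq V$ such that $G[V\setminus S]$ is a 2-club cluster graph; it is inclusion-minimal if no proper subset is a 2-club vertex deletion set. A permanent vertex is one that may not be included in the deletion set. -}

module Defs where

open import Data.Nat using (ℕ)
open import Data.Fin using (Fin)
open import Data.Fin.Subset using (Subset; _∈_; _∉_; _⊆_; _⊂_; _∪_; ⁅_⁆)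
open import Data.Product using (_×_; ∃-syntax)
open import Data.Sum using (_⊎_)
open import Relation.Binary.PropositionalEquality using (_≡_)
open import Relation.Nullary using (¬_)

record Graph (n : ℕ) : Set₁ where
  field
    Adj   : Fin n → Fin n → Set
    sym   : ∀ {u w} → Adj u w → Adj w u
    irrefl : ∀ {u} → ¬ Adj u u
open Graph public

module _ {n : ℕ} (G : Graph n) (S : Subset n) where

  data Connected : Fin n → Fin n → Set where
    here : ∀ {u} → u ∉ S → Connected u u
    step : ∀ {u w z} → u ∉ S → Adj G u w → Connected w z → Connected u z

  Dist≤2 : Fin n → Fin n → Set
  Dist≤2 u w = u ≡ w ⊎ Adj G u w ⊎ (∃[ z ] (z ∉ S × Adj G u z × Adj G z w))

  Is2ClubDeletionSet : Set
  Is2ClubDeletionSet = ∀ u w → Connected u w → Dist≤2 u w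

IsMinimal2ClubDeletionSet : ∀ {n} → Graph n → Subset n → Set
IsMinimal2ClubDeletionSet G S =
  Is2ClubDeletionSet G S × (∀ T → T ⊂ S → ¬ Is2ClubDeletionSet G T)

-- Every neighbour of v lies in S′ ∪ {x} ⊆ S, so v is an isolated vertex of
-- G[V ∖ (S - v)]: putting v back creates a new one-vertex component and leaves all
-- other components untouched.  Hence S - v is again a deletion set and S is not
-- minimal.

module Submission where

open import Defs
open import Data.Nat using (ℕ)
open import Data.Fin using (Fin; _≟_)
open import Data.Fin.Subset using (Subset; _∈_; _∉_; _⊆_; _∪_; ⁅_⁆; _-_)
open import Data.Fin.Subset.Properties
  using (_∈?_; x∈p⇒p-x⊂p; x∈p∧x≢y⇒x∈p-y; x∈p∪q⁺; x∈⁅x⁆)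
open import Data.Product using (_×_; _,_; proj₁)
open import Data.Empty using (⊥-elim)
open import Data.Sum using (_⊎_; inj₁; inj₂)
open import Relation.Binary.PropositionalEquality using (_≡_; _≢_; refl)
open import Relation.Nullary using (¬_; yes; no)

module _ {n : ℕ} (G : Graph n) where

  NeighboursIn : Subset n → Fin n → Set
  NeighboursIn S v = ∀ w → Adj G v w → w ∈ S

  adj⇒≢ : ∀ {u w} → Adj G u w → u ≢ w
  adj⇒≢ a refl = irrefl G a

  Connected-head∉ : ∀ {S u w} → Connected G S u w → u ∉ S
  Connected-head∉ (here u∉S)     = u∉S
  Connected-head∉ (step u∉S _ _) = u∉S

  Dist≤2-antimono : ∀ {S T u w} → T ⊆ S → Dist≤2 G S u w → Dist≤2 G T u w
  Dist≤2-antimono T⊆S (inj₁ u≡w)                       = inj₁ u≡w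
  Dist≤2-antimono T⊆S (inj₂ (inj₁ uw))                 = inj₂ (inj₁ uw)
  Dist≤2-antimono T⊆S (inj₂ (inj₂ (z , z∉S , uz , zw))) =
    inj₂ (inj₂ (z , (λ z∈T → z∉S (T⊆S z∈T)) , uz , zw))

  module _ {S : Subset n} {v : Fin n} (neighbours∈S : NeighboursIn S v) where

    ∉-minus⇒∉ : ∀ {u} → u ∉ S - v → u ≢ v → u ∉ S
    ∉-minus⇒∉ u∉S-v u≢v u∈S = u∉S-v (x∈p∧x≢y⇒x∈p-y u∈S u≢v)

    Connected-minus-isolated : ∀ {u w} → Connected G (S - v) u w →
      (u ≡ v × w ≡ v) ⊎ Connected G S u w
    Connected-minus-isolated {u} (here u∉S-v) with u ≟ v
    ... | yes u≡v = inj₁ (u≡v , u≡v)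
    ... | no  u≢v = inj₂ (here (∉-minus⇒∉ u∉S-v u≢v))
    Connected-minus-isolated {u} (step u∉S-v uz c) with Connected-minus-isolated c | u ≟ v
    ... | inj₁ (refl , _) | _        =
      ⊥-elim (∉-minus⇒∉ u∉S-v (adj⇒≢ uz) (neighbours∈S u (sym G uz)))
    ... | inj₂ c′         | yes refl = ⊥-elim (Connected-head∉ c′ (neighbours∈S _ uz))
    ... | inj₂ c′         | no  u≢v  = inj₂ (step (∉-minus⇒∉ u∉S-v u≢v) uz c′)

    Is2ClubDeletionSet-minus-isolated : v ∈ S → Is2ClubDeletionSet G S →
      Is2ClubDeletionSet G (S - v)
    Is2ClubDeletionSet-minus-isolated v∈S club u w c with Connected-minus-isolated c
    ... | inj₁ (refl , refl) = inj₁ refl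
    ... | inj₂ c′            = Dist≤2-antimono (proj₁ (x∈p⇒p-x⊂p v∈S)) (club u w c′)

    ¬minimal-isolated : v ∈ S → ¬ IsMinimal2ClubDeletionSet G S
    ¬minimal-isolated v∈S (club , minimal) =
      minimal (S - v) (x∈p⇒p-x⊂p v∈S) (Is2ClubDeletionSet-minus-isolated v∈S club)

lemma7 : ∀ {n} (G : Graph n) (S′ : Subset n) (v x : Fin n) →
    v ∈ S′ → Adj G v x → x ∉ S′ →
    (∀ y → Adj G v y → y ∉ S′ → y ≡ x) →
    ∀ (S : Subset n) → ¬ (IsMinimal2ClubDeletionSet G S × (S′ ∪ ⁅ x ⁆) ⊆ S)
lemma7 G S′ v x v∈S′ _ _ unique S (minimalS , S′∪x⊆S) =
  ¬minimal-isolated G neighbours∈S (S′∪x⊆S (x∈p∪q⁺ (inj₁ v∈S′))) minimalS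
  where
  neighbours∈S : NeighboursIn G S v
  neighbours∈S w vw with w ∈? S′
  ... | yes w∈S′ = S′∪x⊆S (x∈p∪q⁺ (inj₁ w∈S′))
  ... | no  w∉S′ with unique w vw w∉S′
  ...   | refl = S′∪x⊆S (x∈p∪q⁺ (inj₂ (x∈⁅x⁆ x)))
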